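{- Let $\alpha$ be a nondegenerate $d$-simplex in the $d$-cube and let $\sigma,\tau$ be exterior faces of $\alpha$. Then the shadow $\pi_\sigma(\tau)$ of $\tau$ with respect to $\sigma$ is an exterior face of $\sigma^\perp$.
   Context: A nondegenerate $d$-simplex in the $d$-cube is the convex hull of $d+1$ affinely independent points of $\{0,1\}^d$. A $j$-face of the cube $[0,1]^d$ is obtained by fixing $d-j$ specified coordinates to specified values in $\{0,1\}$. A $j$-face of a simplex is the convex hull of $j+1$ of its vertices; it is exterior if it is contained in some $j$-face of the cube $[0,1]^d$. For an exterior face $\sigma$, let $S_\sigma$ be the set of coordinates on which the vertices of $\sigma$ are not all equal. The projection along $\sigma$ is the map $\pi_\sigma:[0,1]^d\to[0,1]^d$ replacing each coordinate with index in $S_\sigma$ by $0$; it maps $\sigma$ to a single point. $\sigma^\perp$ is the simplex $\mathrm{conv}\{\pi_\sigma(v): v \text{ a vertex of } \alpha\}$ (of dimension $d-\dim\sigma$, lying in the cube face where the coordinates in $S_\sigma$ are $0$). The shadow of $\tau$ with respect to $\sigma$ is $\pi_\sigma(\tau)$. -}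

module Defs where

open import Data.Bool using (Bool; true; false; if_then_else_; _xor_)
import Data.Bool.Properties as BoolP
open import Data.Nat using (ℕ; zero; suc; _∸_)
open import Data.Fin using (Fin; zero; suc)
open import Data.Fin.Subset using (Subset; _∉_; ∣_∣; Nonempty)
open import Data.Vec using (Vec; lookup; tabulate)
open import Data.Vec.Properties using (≡-dec)
open import Data.List using (List; []; _∷_; map; filterᵇ; length; deduplicate; allFin)
open import Data.Bool.ListAction using (any)
open import Data.List.Membership.Propositional using () renaming (_∈_ to _∈ₗ_)
open import Data.Rational using (ℚ; 0ℚ; 1ℚ; _+_; _*_)
open import Data.Product using (Σ; _×_)
open import Function using (_∘_)
open import Relation.Binary.PropositionalEquality using (_≡_)

-- Vertices of the cube {0,1}^d (false = 0, true = 1).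
Point : ℕ → Set
Point d = Vec Bool d

∑ : ∀ {n} → (Fin n → ℚ) → ℚ
∑ {zero}  f = 0ℚ
∑ {suc n} f = f zero + ∑ (f ∘ suc)

⟦_⟧ : Bool → ℚ
⟦ true ⟧  = 1ℚ
⟦ false ⟧ = 0ℚ

-- Affine independence of a family of cube vertices (over ℚ; the points are
-- rational, so this coincides with affine independence over ℝ).
AffinelyIndependent : ∀ {d m} → (Fin m → Point d) → Set
AffinelyIndependent {d} {m} v =
  (c : Fin m → ℚ) → ∑ c ≡ 0ℚ →
  ((k : Fin d) → ∑ (λ i → c i * ⟦ lookup (v i) k ⟧) ≡ 0ℚ) →
  (i : Fin m) → c i ≡ 0ℚ

Simplex : ℕ → Set
Simplex d = Fin (suc d) → Point d

Nondegenerate : ∀ {d} → Simplex d → Set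
Nondegenerate α = AffinelyIndependent α

-- A j-face of the cube [0,1]^d: the coordinates outside 'free' (d - j of them)
-- are fixed to the values given by 'fixedVal'.
record CubeFace (d j : ℕ) : Set where
  field
    free      : Subset d
    free-size : ∣ free ∣ ≡ j
    fixedVal  : Point d
open CubeFace public

_∈face_ : ∀ {d j} → Point d → CubeFace d j → Set
p ∈face C = ∀ k → k ∉ free C → lookup p k ≡ lookup (fixedVal C) k

vertsOf : ∀ {d m} → (Fin m → Point d) → Subset m → List (Point d)
vertsOf {m = m} v I = map v (filterᵇ (lookup I) (allFin m))

-- Dimension of the convex hull of a set of (distinct) cube vertices,
-- as a face of a simplex: (number of distinct vertices) - 1.
dimPts : ∀ {d} → List (Point d) → ℕ
dimPts ps = length (deduplicate (≡-dec BoolP._≟_) ps) ∸ 1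

-- conv(ps) is contained in some cube face of dimension dim conv(ps)
-- (equivalently all ps lie in it, cube faces being convex).
IsExterior : ∀ {d} → List (Point d) → Set
IsExterior {d} ps = Σ (CubeFace d (dimPts ps)) λ C → ∀ p → p ∈ₗ ps → p ∈face C

ExteriorFace : ∀ {d m} → (Fin m → Point d) → Subset m → Set
ExteriorFace v I = Nonempty I × IsExterior (vertsOf v I)

varies : ∀ {d} → List (Point d) → Fin d → Bool
varies []       k = false
varies (p ∷ qs) k = any (λ q → lookup q k xor lookup p k) qs

proj : ∀ {d} → List (Point d) → Point d → Point d
proj ps p = tabulate (λ k → if varies ps k then false else lookup p k)

perp : ∀ {d} → Simplex d → Subset (suc d) → Simplex d
perp α σ i = proj (vertsOf α σ) (α i)

{-# OPTIONS --safe #-}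

-- Let S be the coordinates flattened by π = π_σ, F the free coordinates of a cube face of
-- dimension dim τ containing τ, and r the number of distinct points π(v), v ∈ τ. These
-- points agree outside F ─ S, so it suffices to show ∣F ─ S∣ ≤ r - 1. Give each vertex
-- v_i ∈ τ the row (e_{π(v_i)}, (v_i)_{F∩S}) in ℚ^r × ℚ^{F∩S}. A dependency c among these
-- rows satisfies Σ c_i g(π(v_i)) = 0 for every g : {0,1}^d → ℚ, hence Σ c_i = 0 (g = 1)
-- and Σ c_i (v_i)_k = 0 for every k: take g = (_)_k if k ∉ S, read it off the second block
-- if k ∈ F ∩ S, and use that (v_i)_k is constant on τ if k ∈ S ─ F. Affine independence
-- forces c = 0, so ∣τ∣ ≤ r + ∣F ∩ S∣; with ∣F∣ = dim τ ≤ ∣τ∣ - 1 this gives the bound.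
module Submission where

open import Defs
open import Algebra.Bundles using (Ring)
open import Data.Bool using (Bool; true; false; if_then_else_; not; _∧_)
open import Data.Bool.Properties using (T-≡) renaming (_≟_ to _≟ᵇ_)
open import Data.Empty using (⊥-elim)
open import Data.Fin using (Fin; zero; suc; punchIn; splitAt; _↑ˡ_; _↑ʳ_) renaming (_≟_ to _≟ᶠ_)
open import Data.Fin.Properties using (punchInᵢ≢i; all?; ¬∀⟶∃¬; splitAt⁻¹-↑ˡ; splitAt⁻¹-↑ʳ)
open import Data.Fin.Subset using (Subset; ∣_∣; ⊤; ∁; _∩_; _─_; _∉_)
open import Data.Fin.Subset.Properties using (∣p∣≤n; ∣⊤∣≡n; ∣∁p∣≡n∸∣p∣)
open import Data.List using (List; filterᵇ; length; deduplicate; allFin)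
import Data.List as List
open import Data.List.Membership.Propositional using () renaming (_∈_ to _∈ₗ_)
open import Data.List.Membership.Propositional.Properties using (∈-map⁺; ∈-map⁻; ∈-filter⁺; ∈-filter⁻; ∈-allFin; ∈-deduplicate⁺)
open import Data.List.Properties using (length-map; length-deduplicate)
import Data.List.Relation.Unary.Any as Any
open import Data.List.Relation.Unary.Any.Properties using (lookup-index)
open import Data.Nat using (ℕ; zero; suc; _≤_; z≤n; s≤s; s≤s⁻¹; _∸_) renaming (_+_ to _+ℕ_)
open import Data.Nat.Properties
  using ( m≤n⇒m≤1+n; ≤-trans; ≤-reflexive; ≤-antisym; ≰⇒>; ∸-monoˡ-≤; +-cancelˡ-≤; m∸n+n≡m
        ; +-comm; +-suc; n≤0⇒n≡0; m≤n+m; m≤m+n; 1+n≰n)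
  renaming (_≤?_ to _≤ℕ?_)
open import Data.Product using (∃; _×_; _,_; proj₁; proj₂)
open import Data.Sum using (inj₁; inj₂)
open import Data.Rational using (ℚ; 0ℚ; 1ℚ; _+_; _*_; -_; _-_; 1/_; ≢-nonZero)
open import Data.Rational.Properties
  using (+-*-ring; 1≢0; +-identityʳ; *-zeroˡ; *-zeroʳ; *-identityˡ; *-identityʳ; *-assoc; *-inverseˡ) renaming (_≟_ to _≟ℚ_)
open import Data.Rational.Solver using (module +-*-Solver)
open import Data.Vec using ([]; _∷_; lookup; tabulate; _++_)
open import Data.Vec.Properties
  using (≡-dec; lookup∘tabulate; lookup-zipWith; lookup-map; lookup-replicate; lookup-++ˡ; lookup-++ʳ; []=⇒lookup; lookup⇒[]=)
import Data.Vec.Functional as Vector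
import Data.Vec.Functional.Properties as Vector
open import Data.Vec.Functional.Properties using (insertAt-lookup; insertAt-punchIn)
open import Function using (_∘_; const; Equivalence)
open import Relation.Nullary using (Dec; yes; no; does; contradiction)
open import Relation.Nullary.Decidable using (T?; dec-true; dec-false)
open import Relation.Binary.PropositionalEquality

open import Algebra.Properties.Semiring.Sum (Ring.semiring +-*-ring)
  using (sum; sum-cong-≗; sum-replicate-zero; sum-remove; ∑-distrib-+; ∑-comm; *-distribˡ-sum; *-distribʳ-sum)

open ≡-Reasoning
open +-*-Solver using (solve; _:+_; _:*_; :-_; _:-_; _:=_; con)

∑≡sum : ∀ {n} (f : Fin n → ℚ) → ∑ f ≡ sum f
∑≡sum {zero}  f = refl
∑≡sum {suc n} f = cong (f zero +_) (∑≡sum (f ∘ suc))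

sum-zero : ∀ {n} {f : Fin n → ℚ} → (∀ i → f i ≡ 0ℚ) → sum f ≡ 0ℚ
sum-zero {n} f≡0 = trans (sum-cong-≗ f≡0) (sum-replicate-zero n)

sum-pick : ∀ {n} (i : Fin (suc n)) {f : Fin (suc n) → ℚ} → (∀ j → j ≢ i → f j ≡ 0ℚ) → sum f ≡ f i
sum-pick i {f} f≡0 = begin
  sum f                                ≡⟨ sum-remove {i = i} f ⟩
  f i + sum (f ∘ punchIn i)            ≡⟨ cong (f i +_) (sum-zero (λ j → f≡0 (punchIn i j) (punchInᵢ≢i i j))) ⟩
  f i + 0ℚ                             ≡⟨ +-identityʳ (f i) ⟩
  f i                                  ∎

*-cancelˡ-≡0 : ∀ a b → a ≢ 0ℚ → a * b ≡ 0ℚ → b ≡ 0ℚ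
*-cancelˡ-≡0 a b a≢0 ab≡0 = begin
  b                  ≡⟨ sym (*-identityˡ b) ⟩
  1ℚ * b             ≡⟨ cong (_* b) (sym (*-inverseˡ a {{≢-nonZero a≢0}})) ⟩
  (a⁻¹ * a) * b      ≡⟨ *-assoc a⁻¹ a b ⟩
  a⁻¹ * (a * b)      ≡⟨ cong (a⁻¹ *_) ab≡0 ⟩
  a⁻¹ * 0ℚ           ≡⟨ *-zeroʳ a⁻¹ ⟩
  0ℚ                 ∎
  where a⁻¹ = (1/ a) {{≢-nonZero a≢0}}

δ : ∀ {n} → Fin n → Fin n → ℚ
δ i j = if does (i ≟ᶠ j) then 1ℚ else 0ℚ

δ-diag : ∀ {n} (i : Fin n) → δ i i ≡ 1ℚ
δ-diag i = cong (if_then 1ℚ else 0ℚ) (dec-true (i ≟ᶠ i) refl)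

δ-off : ∀ {n} {i j : Fin n} → i ≢ j → δ i j ≡ 0ℚ
δ-off {i = i} {j} i≢j = cong (if_then 1ℚ else 0ℚ) (dec-false (i ≟ᶠ j) i≢j)

sum-δˡ : ∀ {n} (i : Fin n) (f : Fin n → ℚ) → sum (λ j → δ i j * f j) ≡ f i
sum-δˡ {suc n} i f = begin
  sum (λ j → δ i j * f j)   ≡⟨ sum-pick i (λ j j≢i → trans (cong (_* f j) (δ-off (j≢i ∘ sym))) (*-zeroˡ (f j))) ⟩
  δ i i * f i               ≡⟨ cong (_* f i) (δ-diag i) ⟩
  1ℚ * f i                  ≡⟨ *-identityˡ (f i) ⟩
  f i                       ∎

sum-δʳ : ∀ {n} (j : Fin n) (f : Fin n → ℚ) → sum (λ i → f i * δ i j) ≡ f j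
sum-δʳ {suc n} j f = begin
  sum (λ i → f i * δ i j)   ≡⟨ sum-pick j (λ i i≢j → trans (cong (f i *_) (δ-off i≢j)) (*-zeroʳ (f i))) ⟩
  f j * δ j j               ≡⟨ cong (f j *_) (δ-diag j) ⟩
  f j * 1ℚ                  ≡⟨ *-identityʳ (f j) ⟩
  f j                       ∎

Annihilates : ∀ {m n} → (Fin m → ℚ) → (Fin m → Fin n → ℚ) → Set
Annihilates c w = ∀ k → sum (λ i → c i * w i k) ≡ 0ℚ

LinearlyIndependent : ∀ {m n} → (Fin m → Fin n → ℚ) → Set
LinearlyIndependent w = ∀ c → Annihilates c w → ∀ i → c i ≡ 0ℚ

SupportedOn : ∀ {m n} → Subset n → (Fin m → Fin n → ℚ) → Set
SupportedOn Z w = ∀ i k → lookup Z k ≡ false → w i k ≡ 0ℚ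

annihilates-combination : ∀ {m n} (c : Fin m → ℚ) (w : Fin m → Fin n → ℚ) →
  Annihilates c w → (g : Fin n → ℚ) → sum (λ i → c i * sum (λ k → w i k * g k)) ≡ 0ℚ
annihilates-combination c w ann g = begin
  sum (λ i → c i * sum (λ k → w i k * g k))    ≡⟨ sum-cong-≗ (λ i → *-distribˡ-sum (c i) (λ k → w i k * g k)) ⟩
  sum (λ i → sum (λ k → c i * (w i k * g k)))  ≡⟨ ∑-comm (λ i k → c i * (w i k * g k)) ⟩
  sum (λ k → sum (λ i → c i * (w i k * g k)))  ≡⟨ sum-cong-≗ (λ k → sum-cong-≗ (λ i → sym (*-assoc (c i) (w i k) (g k)))) ⟩
  sum (λ k → sum (λ i → c i * w i k * g k))    ≡⟨ sum-cong-≗ (λ k → sym (*-distribʳ-sum (g k) (λ i → c i * w i k))) ⟩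
  sum (λ k → sum (λ i → c i * w i k) * g k)    ≡⟨ sum-zero (λ k → trans (cong (_* g k) (ann k)) (*-zeroˡ (g k))) ⟩
  0ℚ                                           ∎

dropFirstColumn : ∀ {m n} → (Fin m → Fin (suc n) → ℚ) → Fin m → Fin n → ℚ
dropFirstColumn w i k = w i (suc k)

independent-dropZeroColumn : ∀ {m n} (w : Fin m → Fin (suc n) → ℚ) → (∀ i → w i zero ≡ 0ℚ) →
  LinearlyIndependent w → LinearlyIndependent (dropFirstColumn w)
independent-dropZeroColumn w w₀≡0 ind c ann = ind c λ where
  zero    → sum-zero (λ i → trans (cong (c i *_) (w₀≡0 i)) (*-zeroʳ (c i)))
  (suc k) → ann k

supportedOn-dropFirstColumn : ∀ {m n} {b} {Z : Subset n} (w : Fin m → Fin (suc n) → ℚ) →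
  SupportedOn (b ∷ Z) w → SupportedOn Z (dropFirstColumn w)
supportedOn-dropFirstColumn w supp i k = supp i (suc k)

module Elimination {m n} (w : Fin (suc m) → Fin (suc n) → ℚ) (j : Fin (suc m)) where

  pivot : ℚ
  pivot = w j zero

  rest : Fin m → Fin (suc n) → ℚ
  rest i = w (punchIn j i)

  reduced : Fin m → Fin (suc n) → ℚ
  reduced i k = pivot * rest i k - rest i zero * w j k

  eliminate : Fin m → Fin n → ℚ
  eliminate i k = reduced i (suc k)

  reduced-pivotColumn : ∀ i → reduced i zero ≡ 0ℚ
  reduced-pivotColumn i = solve 2 (λ a x → a :* x :- x :* a := con 0ℚ) refl pivot (rest i zero)

  -- A dependency c of the reduced rows lifts to the dependency `lift c` of the rows of w.
  lift : (Fin m → ℚ) → Fin (suc m) → ℚ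
  lift c = Vector.insertAt (λ i → pivot * c i) j (- sum (λ i → c i * rest i zero))

  sum-lift : ∀ c k → sum (λ x → lift c x * w x k) ≡ sum (λ i → c i * reduced i k)
  sum-lift c k = begin
    sum (λ x → lift c x * w x k)
      ≡⟨ sum-remove {i = j} (λ x → lift c x * w x k) ⟩
    lift c j * w j k + sum (λ i → lift c (punchIn j i) * rest i k)
      ≡⟨ cong₂ _+_ (cong (_* w j k) (insertAt-lookup _ j _)) (sum-cong-≗ (λ i → cong (_* rest i k) (insertAt-punchIn _ j _ i))) ⟩
    - G * w j k + sum (λ i → pivot * c i * rest i k)
      ≡⟨ cong (_+ sum (λ i → pivot * c i * rest i k)) (solve 2 (λ g x → (:- g) :* x := g :* (:- x)) refl G (w j k)) ⟩
    G * - w j k + sum (λ i → pivot * c i * rest i k)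
      ≡⟨ cong (_+ sum (λ i → pivot * c i * rest i k)) (*-distribʳ-sum (- w j k) (λ i → c i * rest i zero)) ⟩
    sum (λ i → c i * rest i zero * - w j k) + sum (λ i → pivot * c i * rest i k)
      ≡⟨ ∑-distrib-+ (λ i → c i * rest i zero * - w j k) (λ i → pivot * c i * rest i k) ⟨
    sum (λ i → c i * rest i zero * - w j k + pivot * c i * rest i k)
      ≡⟨ sum-cong-≗ (λ i → solve 5 (λ cᵢ r₀ x a r → cᵢ :* r₀ :* (:- x) :+ a :* cᵢ :* r := cᵢ :* (a :* r :- r₀ :* x))
                                   refl (c i) (rest i zero) (w j k) pivot (rest i k)) ⟩
    sum (λ i → c i * reduced i k) ∎
    where G = sum (λ i → c i * rest i zero)

  independent-eliminate : pivot ≢ 0ℚ → LinearlyIndependent w → LinearlyIndependent eliminate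
  independent-eliminate pivot≢0 ind c ann i =
    *-cancelˡ-≡0 pivot (c i) pivot≢0 (trans (sym (insertAt-punchIn _ j _ i)) (ind (lift c) lift-ann (punchIn j i)))
    where
    lift-ann : Annihilates (lift c) w
    lift-ann zero    = trans (sum-lift c zero) (sum-zero (λ i → trans (cong (c i *_) (reduced-pivotColumn i)) (*-zeroʳ (c i))))
    lift-ann (suc k) = trans (sum-lift c (suc k)) (ann k)

  supportedOn-eliminate : ∀ {b} {Z : Subset n} → SupportedOn (b ∷ Z) w → SupportedOn Z eliminate
  supportedOn-eliminate supp i k k∉Z = begin
    pivot * rest i (suc k) - rest i zero * w j (suc k)
      ≡⟨ cong₂ (λ x y → pivot * x - rest i zero * y) (supp (punchIn j i) (suc k) k∉Z) (supp j (suc k) k∉Z) ⟩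
    pivot * 0ℚ - rest i zero * 0ℚ
      ≡⟨ solve 2 (λ a r → a :* con 0ℚ :- r :* con 0ℚ := con 0ℚ) refl pivot (rest i zero) ⟩
    0ℚ ∎

independent⇒≤∣support∣ : ∀ {m n} (Z : Subset n) (w : Fin m → Fin n → ℚ) →
  LinearlyIndependent w → SupportedOn Z w → m ≤ ∣ Z ∣
independent⇒≤∣support∣ {zero}  _           _ _   _    = z≤n
independent⇒≤∣support∣ {suc m} []          w ind _    = ⊥-elim (1≢0 (ind (const 1ℚ) (λ ()) zero))
independent⇒≤∣support∣ {suc m} (false ∷ Z) w ind supp =
  independent⇒≤∣support∣ Z (dropFirstColumn w)
    (independent-dropZeroColumn w (λ i → supp i zero refl) ind) (supportedOn-dropFirstColumn w supp)
independent⇒≤∣support∣ {suc m} (true ∷ Z)  w ind supp with all? (λ i → w i zero ≟ℚ 0ℚ)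
... | yes w₀≡0 = m≤n⇒m≤1+n (independent⇒≤∣support∣ Z (dropFirstColumn w)
                   (independent-dropZeroColumn w w₀≡0 ind) (supportedOn-dropFirstColumn w supp))
... | no  w₀≢0 with ¬∀⟶∃¬ _ _ (λ i → w i zero ≟ℚ 0ℚ) w₀≢0
...   | j , pivot≢0 = s≤s (independent⇒≤∣support∣ Z eliminate (independent-eliminate pivot≢0 ind) (supportedOn-eliminate supp))
  where open Elimination w j

_∥_ : ∀ {m n₁ n₂} → (Fin m → Fin n₁ → ℚ) → (Fin m → Fin n₂ → ℚ) → Fin m → Fin (n₁ +ℕ n₂) → ℚ
(u ∥ v) i = u i Vector.++ v i

annihilates-∥⁻ : ∀ {m n₁ n₂} (c : Fin m → ℚ) (u : Fin m → Fin n₁ → ℚ) (v : Fin m → Fin n₂ → ℚ) →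
  Annihilates c (u ∥ v) → Annihilates c u × Annihilates c v
annihilates-∥⁻ {n₁ = n₁} {n₂} c u v ann =
  (λ k → trans (sum-cong-≗ (λ i → cong (c i *_) (sym (Vector.lookup-++ˡ (u i) (v i) k)))) (ann (k ↑ˡ n₂))) ,
  (λ k → trans (sum-cong-≗ (λ i → cong (c i *_) (sym (Vector.lookup-++ʳ (u i) (v i) k)))) (ann (n₁ ↑ʳ k)))

supportedOn-∥ : ∀ {m n₁ n₂} (Z₁ : Subset n₁) (Z₂ : Subset n₂)
  {u : Fin m → Fin n₁ → ℚ} {v : Fin m → Fin n₂ → ℚ} →
  SupportedOn Z₁ u → SupportedOn Z₂ v → SupportedOn (Z₁ ++ Z₂) (u ∥ v)
supportedOn-∥ {n₁ = n₁} Z₁ Z₂ supp₁ supp₂ i col col∉Z with splitAt n₁ col in split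
... | inj₁ k = supp₁ i k (trans (sym (lookup-++ˡ Z₁ Z₂ k)) (trans (cong (lookup (Z₁ ++ Z₂)) (splitAt⁻¹-↑ˡ split)) col∉Z))
... | inj₂ k = supp₂ i k (trans (sym (lookup-++ʳ Z₁ Z₂ k)) (trans (cong (lookup (Z₁ ++ Z₂)) (splitAt⁻¹-↑ʳ split)) col∉Z))

∣p++q∣≡∣p∣+∣q∣ : ∀ {m n} (p : Subset m) (q : Subset n) → ∣ p ++ q ∣ ≡ ∣ p ∣ +ℕ ∣ q ∣
∣p++q∣≡∣p∣+∣q∣ []          q = refl
∣p++q∣≡∣p∣+∣q∣ (true ∷ p)  q = cong suc (∣p++q∣≡∣p∣+∣q∣ p q)
∣p++q∣≡∣p∣+∣q∣ (false ∷ p) q = ∣p++q∣≡∣p∣+∣q∣ p q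

VanishesOff : ∀ {m} → Subset m → (Fin m → ℚ) → Set
VanishesOff R c = ∀ i → lookup R i ≡ false → c i ≡ 0ℚ

LinearlyIndependentOn : ∀ {m n} → Subset m → (Fin m → Fin n → ℚ) → Set
LinearlyIndependentOn R w = ∀ c → VanishesOff R c → Annihilates c w → ∀ i → c i ≡ 0ℚ

sum-*-congOn : ∀ {m} {R : Subset m} {c : Fin m → ℚ} (f g : Fin m → ℚ) → VanishesOff R c →
  (∀ i → lookup R i ≡ true → f i ≡ g i) → sum (λ i → c i * f i) ≡ sum (λ i → c i * g i)
sum-*-congOn {R = R} {c} f g c-off f≡g = sum-cong-≗ pointwise
  where
  pointwise : ∀ i → c i * f i ≡ c i * g i
  pointwise i with lookup R i in i∈R
  ... | true  = cong (c i *_) (f≡g i i∈R)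
  ... | false = begin
    c i * f i  ≡⟨ cong (_* f i) (c-off i i∈R) ⟩
    0ℚ * f i   ≡⟨ *-zeroˡ (f i) ⟩
    0ℚ         ≡⟨ *-zeroˡ (g i) ⟨
    0ℚ * g i   ≡⟨ cong (_* g i) (c-off i i∈R) ⟨
    c i * g i  ∎

unitColumnsOff : ∀ {m} → Subset m → Fin m → Fin m → ℚ
unitColumnsOff R i j = if lookup R j then 0ℚ else δ i j

unitColumnsOff-supportedOn : ∀ {m} (R : Subset m) → SupportedOn (∁ R) (unitColumnsOff R)
unitColumnsOff-supportedOn R i j j∉∁R with lookup R j in j∈R
... | true  = refl
... | false with () ← trans (sym (trans (lookup-map j not R) (cong not j∈R))) j∉∁R

annihilates-unitColumnsOff⇒vanishesOff : ∀ {m} {R : Subset m} {c : Fin m → ℚ} →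
  Annihilates c (unitColumnsOff R) → VanishesOff R c
annihilates-unitColumnsOff⇒vanishesOff {R = R} {c} ann j j∉R = begin
  c j                                    ≡⟨ sum-δʳ j c ⟨
  sum (λ i → c i * δ i j)                ≡⟨ sum-cong-≗ (λ i → cong (λ b → c i * (if b then 0ℚ else δ i j)) j∉R) ⟨
  sum (λ i → c i * unitColumnsOff R i j) ≡⟨ ann j ⟩
  0ℚ                                     ∎

-- Appending the unit columns e_j (j ∉ R) forces the coefficients off R to vanish, so
-- independence on R becomes plain independence at the cost of m ∸ ∣ R ∣ extra columns.
independentOn⇒∣R∣≤∣support∣ : ∀ {m n} (R : Subset m) (Z : Subset n) (w : Fin m → Fin n → ℚ) →
  LinearlyIndependentOn R w → SupportedOn Z w → ∣ R ∣ ≤ ∣ Z ∣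
independentOn⇒∣R∣≤∣support∣ {m} R Z w ind supp =
  +-cancelˡ-≤ (m ∸ ∣ R ∣) ∣ R ∣ ∣ Z ∣
    (≤-trans (≤-reflexive (m∸n+n≡m (∣p∣≤n R))) (≤-trans m≤∣Z∣+∣∁R∣ (≤-reflexive (+-comm ∣ Z ∣ (m ∸ ∣ R ∣)))))
  where
  extended-ind : LinearlyIndependent (w ∥ unitColumnsOff R)
  extended-ind c ann with annihilates-∥⁻ c w (unitColumnsOff R) ann
  ... | ann-w , ann-unit = ind c (annihilates-unitColumnsOff⇒vanishesOff {R = R} ann-unit) ann-w

  m≤∣Z∣+∣∁R∣ : m ≤ ∣ Z ∣ +ℕ (m ∸ ∣ R ∣)
  m≤∣Z∣+∣∁R∣ = subst (m ≤_) (trans (∣p++q∣≡∣p∣+∣q∣ Z (∁ R)) (cong (∣ Z ∣ +ℕ_) (∣∁p∣≡n∸∣p∣ R)))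
    (independent⇒≤∣support∣ (Z ++ ∁ R) (w ∥ unitColumnsOff R) extended-ind
      (supportedOn-∥ Z (∁ R) supp (unitColumnsOff-supportedOn R)))

m+n≤o∸1⇒o≤p+m⇒n≤p∸1 : ∀ m n o p → m +ℕ n ≤ o ∸ 1 → o ≤ p +ℕ m → n ≤ p ∸ 1
m+n≤o∸1⇒o≤p+m⇒n≤p∸1 m n zero    p       m+n≤0  _     =
  subst (_≤ p ∸ 1) (sym (n≤0⇒n≡0 (≤-trans (m≤n+m n m) m+n≤0))) z≤n
m+n≤o∸1⇒o≤p+m⇒n≤p∸1 m n (suc o) zero    m+n≤o  o<m   =
  ⊥-elim (1+n≰n (≤-trans (s≤s (≤-trans (m≤m+n m n) m+n≤o)) o<m))
m+n≤o∸1⇒o≤p+m⇒n≤p∸1 m n (suc o) (suc p) m+n≤o  o<p+m =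
  +-cancelˡ-≤ m n p (≤-trans m+n≤o (≤-trans (s≤s⁻¹ o<p+m) (≤-reflexive (+-comm p m))))

∣p∩q∣+∣p─q∣≡∣p∣ : ∀ {n} (p q : Subset n) → ∣ p ∩ q ∣ +ℕ ∣ p ─ q ∣ ≡ ∣ p ∣
∣p∩q∣+∣p─q∣≡∣p∣ []          []          = refl
∣p∩q∣+∣p─q∣≡∣p∣ (true ∷ p)  (true ∷ q)  = cong suc (∣p∩q∣+∣p─q∣≡∣p∣ p q)
∣p∩q∣+∣p─q∣≡∣p∣ (true ∷ p)  (false ∷ q) =
  trans (+-suc ∣ p ∩ q ∣ ∣ p ─ q ∣) (cong suc (∣p∩q∣+∣p─q∣≡∣p∣ p q))
∣p∩q∣+∣p─q∣≡∣p∣ (false ∷ p) (true ∷ q)  = ∣p∩q∣+∣p─q∣≡∣p∣ p q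
∣p∩q∣+∣p─q∣≡∣p∣ (false ∷ p) (false ∷ q) = ∣p∩q∣+∣p─q∣≡∣p∣ p q

lookup-∩ : ∀ {n} (p q : Subset n) k → lookup (p ∩ q) k ≡ lookup p k ∧ lookup q k
lookup-∩ p q k = lookup-zipWith _∧_ k p q

lookup-─-outside : ∀ {n} (p q : Subset n) k → lookup q k ≡ false → lookup (p ─ q) k ≡ lookup p k
lookup-─-outside (x ∷ p) (false ∷ q) zero    _  = refl
lookup-─-outside (x ∷ p) (y ∷ q)     (suc k) qk = lookup-─-outside p q k qk

superset-of-size : ∀ {n} (V : Subset n) j → ∣ V ∣ ≤ j → j ≤ n →
  ∃ λ (Y : Subset n) → ∣ Y ∣ ≡ j × (∀ k → lookup V k ≡ true → lookup Y k ≡ true)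
superset-of-size []          zero    _          _          = [] , refl , λ ()
superset-of-size (true ∷ V)  (suc j) (s≤s ∣V∣≤j) (s≤s j≤n) with superset-of-size V j ∣V∣≤j j≤n
... | Y , ∣Y∣≡j , V⊆Y = true ∷ Y , cong suc ∣Y∣≡j , λ { zero _ → refl ; (suc k) → V⊆Y k }
superset-of-size {suc n} (false ∷ V) j ∣V∣≤j j≤1+n with j ≤ℕ? n
... | yes j≤n with superset-of-size V j ∣V∣≤j j≤n
...   | Y , ∣Y∣≡j , V⊆Y = false ∷ Y , ∣Y∣≡j , λ { zero () ; (suc k) → V⊆Y k }
superset-of-size {suc n} (false ∷ V) j ∣V∣≤j j≤1+n | no j≰n =
  ⊤ , trans (∣⊤∣≡n (suc n)) (≤-antisym (≰⇒> j≰n) j≤1+n) , λ k _ → lookup-replicate k true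

⊆-outside : ∀ {n} {V Y : Subset n} → (∀ k → lookup V k ≡ true → lookup Y k ≡ true) →
  ∀ k → lookup Y k ≡ false → lookup V k ≡ false
⊆-outside {V = V} V⊆Y k k∉Y with lookup V k in k∈V
... | true  with () ← trans (sym (V⊆Y k k∈V)) k∉Y
... | false = refl

length-filterᵇ-tabulate : ∀ {A : Set} {n} (I : Subset n) (f : Fin n → A) (P : A → Bool) →
  (∀ i → P (f i) ≡ lookup I i) → length (filterᵇ P (List.tabulate f)) ≡ ∣ I ∣
length-filterᵇ-tabulate []      f P P∘f≡I = refl
length-filterᵇ-tabulate (b ∷ I) f P P∘f≡I with P (f zero) | P∘f≡I zero
... | true  | refl = cong suc (length-filterᵇ-tabulate I (f ∘ suc) P (P∘f≡I ∘ suc))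
... | false | refl = length-filterᵇ-tabulate I (f ∘ suc) P (P∘f≡I ∘ suc)

length-vertsOf : ∀ {d m} (v : Fin m → Point d) (I : Subset m) → length (vertsOf v I) ≡ ∣ I ∣
length-vertsOf {m = m} v I =
  trans (length-map v (filterᵇ (lookup I) (allFin m))) (length-filterᵇ-tabulate I (λ i → i) (lookup I) (λ _ → refl))

∈-vertsOf⁺ : ∀ {d m} (v : Fin m → Point d) (I : Subset m) {i} → lookup I i ≡ true → v i ∈ₗ vertsOf v I
∈-vertsOf⁺ v I {i} i∈I = ∈-map⁺ v (∈-filter⁺ (T? ∘ lookup I) (∈-allFin i) (Equivalence.from T-≡ i∈I))

∈-vertsOf⁻ : ∀ {d m} (v : Fin m → Point d) (I : Subset m) {p} → p ∈ₗ vertsOf v I → ∃ λ i → lookup I i ≡ true × p ≡ v i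
∈-vertsOf⁻ v I p∈ with ∈-map⁻ v p∈
... | i , i∈filter , p≡vi = i , Equivalence.to T-≡ (proj₂ (∈-filter⁻ (T? ∘ lookup I) {xs = allFin _} i∈filter)) , p≡vi

lookup≡false⇒∉ : ∀ {n} {p : Subset n} {k} → lookup p k ≡ false → k ∉ p
lookup≡false⇒∉ pk≡false k∈p with () ← trans (sym ([]=⇒lookup k∈p)) pk≡false

∉⇒lookup≡false : ∀ {n} {p : Subset n} {k} → k ∉ p → lookup p k ≡ false
∉⇒lookup≡false {p = p} {k} k∉p with lookup p k in pk
... | true  = ⊥-elim (k∉p (lookup⇒[]= k p pk))
... | false = refl

module Shadow {d} (α : Simplex d) (nd : Nondegenerate α)
  (S : Subset d) (π : Point d → Point d)
  (π-keeps : ∀ p k → lookup S k ≡ false → lookup (π p) k ≡ lookup p k)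
  (π-flattens : ∀ p q k → lookup S k ≡ true → lookup (π p) k ≡ lookup (π q) k)
  (τ : Subset (suc d)) (C : CubeFace d (dimPts (vertsOf α τ)))
  (τ⊆C : ∀ p → p ∈ₗ vertsOf α τ → p ∈face C) where

  F : Subset d
  F = free C

  shadow : List (Point d)
  shadow = vertsOf (π ∘ α) τ

  D : List (Point d)
  D = deduplicate (≡-dec _≟ᵇ_) shadow

  r : ℕ
  r = length D

  vertex-off-F : ∀ {i} k → lookup τ i ≡ true → lookup F k ≡ false → lookup (α i) k ≡ lookup (fixedVal C) k
  vertex-off-F {i} k i∈τ k∉F = τ⊆C (α i) (∈-vertsOf⁺ α τ i∈τ) k (lookup≡false⇒∉ k∉F)

  π∘α∈D : ∀ {i} → lookup τ i ≡ true → π (α i) ∈ₗ D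
  π∘α∈D i∈τ = ∈-deduplicate⁺ (≡-dec _≟ᵇ_) (∈-vertsOf⁺ (π ∘ α) τ i∈τ)

  pointRow : ∀ {i} → Dec (lookup τ i ≡ true) → Fin r → ℚ
  pointRow (yes i∈τ) j = δ (Any.index (π∘α∈D i∈τ)) j
  pointRow (no _)    _ = 0ℚ

  pointColumns : Fin (suc d) → Fin r → ℚ
  pointColumns i = pointRow (lookup τ i ≟ᵇ true)

  pointRow-combination : ∀ {i} (i∈τ? : Dec (lookup τ i ≡ true)) → lookup τ i ≡ true → (g : Point d → ℚ) →
    sum (λ j → pointRow i∈τ? j * g (List.lookup D j)) ≡ g (π (α i))
  pointRow-combination (yes i∈τ) _ g = trans (sum-δˡ _ (g ∘ List.lookup D)) (cong g (sym (lookup-index (π∘α∈D i∈τ))))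
  pointRow-combination (no i∉τ)  i∈τ _ = contradiction i∈τ i∉τ

  coordColumns : Fin (suc d) → Fin d → ℚ
  coordColumns i k = if lookup (F ∩ S) k then ⟦ lookup (α i) k ⟧ else 0ℚ

  rows : Fin (suc d) → Fin (r +ℕ d) → ℚ
  rows = pointColumns ∥ coordColumns

  rows-supportedOn : SupportedOn (⊤ {r} ++ F ∩ S) rows
  rows-supportedOn = supportedOn-∥ ⊤ (F ∩ S)
    (λ i j j∉⊤ → contradiction (trans (sym (lookup-replicate j true)) j∉⊤) λ ())
    (λ i k k∉F∩S → cong (if_then ⟦ lookup (α i) k ⟧ else 0ℚ) k∉F∩S)

  rows-independentOn : LinearlyIndependentOn τ rows
  rows-independentOn c c-off ann with annihilates-∥⁻ c pointColumns coordColumns ann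
  ... | ann-point , ann-coord =
    nd c (trans (∑≡sum c) sum-c≡0) (λ k → trans (∑≡sum (λ i → c i * ⟦ lookup (α i) k ⟧)) (coordinate k))
    where
    through-shadow : (g : Point d → ℚ) → sum (λ i → c i * g (π (α i))) ≡ 0ℚ
    through-shadow g = begin
      sum (λ i → c i * g (π (α i)))
        ≡⟨ sum-*-congOn {R = τ} _ (λ i → sum (λ j → pointColumns i j * g (List.lookup D j))) c-off
             (λ i i∈τ → sym (pointRow-combination (lookup τ i ≟ᵇ true) i∈τ g)) ⟩
      sum (λ i → c i * sum (λ j → pointColumns i j * g (List.lookup D j)))
        ≡⟨ annihilates-combination c pointColumns ann-point (g ∘ List.lookup D) ⟩
      0ℚ ∎

    sum-c≡0 : sum c ≡ 0ℚ
    sum-c≡0 = trans (sum-cong-≗ (λ i → sym (*-identityʳ (c i)))) (through-shadow (const 1ℚ))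

    coordinate : ∀ k → sum (λ i → c i * ⟦ lookup (α i) k ⟧) ≡ 0ℚ
    coordinate k with lookup S k in k∈S | lookup F k in k∈F
    ... | false | _     = trans (sum-cong-≗ (λ i → cong (λ b → c i * ⟦ b ⟧) (sym (π-keeps (α i) k k∈S))))
                                (through-shadow (λ p → ⟦ lookup p k ⟧))
    ... | true  | true  = trans (sum-cong-≗ (λ i → cong (λ b → c i * (if b then ⟦ lookup (α i) k ⟧ else 0ℚ))
                                                         (sym (trans (lookup-∩ F S k) (cong₂ _∧_ k∈F k∈S)))))
                                (ann-coord k)
    ... | true  | false = begin
      sum (λ i → c i * ⟦ lookup (α i) k ⟧)
        ≡⟨ sum-*-congOn {R = τ} _ (const x) c-off (λ i i∈τ → cong ⟦_⟧ (vertex-off-F k i∈τ k∈F)) ⟩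
      sum (λ i → c i * x)                    ≡⟨ *-distribʳ-sum x c ⟨
      sum c * x                              ≡⟨ cong (_* x) sum-c≡0 ⟩
      0ℚ * x                                 ≡⟨ *-zeroˡ x ⟩
      0ℚ                                     ∎
      where x = ⟦ lookup (fixedVal C) k ⟧

  ∣τ∣≤r+∣F∩S∣ : ∣ τ ∣ ≤ r +ℕ ∣ F ∩ S ∣
  ∣τ∣≤r+∣F∩S∣ =
    subst (∣ τ ∣ ≤_) (trans (∣p++q∣≡∣p∣+∣q∣ (⊤ {r}) (F ∩ S)) (cong (_+ℕ ∣ F ∩ S ∣) (∣⊤∣≡n r)))
    (independentOn⇒∣R∣≤∣support∣ τ (⊤ ++ F ∩ S) rows rows-independentOn rows-supportedOn)

  ∣F∣≤∣τ∣∸1 : ∣ F ∣ ≤ ∣ τ ∣ ∸ 1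
  ∣F∣≤∣τ∣∸1 = ≤-trans (≤-reflexive (free-size C))
    (≤-trans (∸-monoˡ-≤ 1 (length-deduplicate (≡-dec _≟ᵇ_) (vertsOf α τ))) (≤-reflexive (cong (_∸ 1) (length-vertsOf α τ))))

  ∣F─S∣≤r∸1 : ∣ F ─ S ∣ ≤ r ∸ 1
  ∣F─S∣≤r∸1 = m+n≤o∸1⇒o≤p+m⇒n≤p∸1 (∣ F ∩ S ∣) (∣ F ─ S ∣) (∣ τ ∣) r
    (subst (_≤ ∣ τ ∣ ∸ 1) (sym (∣p∩q∣+∣p─q∣≡∣p∣ F S)) ∣F∣≤∣τ∣∸1) ∣τ∣≤r+∣F∩S∣

  r∸1≤d : r ∸ 1 ≤ d
  r∸1≤d = ∸-monoˡ-≤ 1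
    (≤-trans (length-deduplicate (≡-dec _≟ᵇ_) shadow) (≤-trans (≤-reflexive (length-vertsOf (π ∘ α) τ)) (∣p∣≤n τ)))

  enlarged : ∃ λ (Y : Subset d) → ∣ Y ∣ ≡ r ∸ 1 × (∀ k → lookup (F ─ S) k ≡ true → lookup Y k ≡ true)
  enlarged = superset-of-size (F ─ S) (r ∸ 1) ∣F─S∣≤r∸1 r∸1≤d

  Y : Subset d
  Y = proj₁ enlarged

  F─S⊆Y : ∀ k → lookup (F ─ S) k ≡ true → lookup Y k ≡ true
  F─S⊆Y = proj₂ (proj₂ enlarged)

  shadowFace : CubeFace d (dimPts shadow)
  shadowFace = record { free = Y ; free-size = proj₁ (proj₂ enlarged) ; fixedVal = π (fixedVal C) }

  shadow-off-F─S : ∀ {i} k → lookup τ i ≡ true → lookup (F ─ S) k ≡ false →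
    lookup (π (α i)) k ≡ lookup (π (fixedVal C)) k
  shadow-off-F─S {i} k i∈τ k∉F─S with lookup S k in k∈S
  ... | true  = π-flattens (α i) (fixedVal C) k k∈S
  ... | false = begin
    lookup (π (α i)) k          ≡⟨ π-keeps (α i) k k∈S ⟩
    lookup (α i) k              ≡⟨ vertex-off-F k i∈τ (trans (sym (lookup-─-outside F S k k∈S)) k∉F─S) ⟩
    lookup (fixedVal C) k       ≡⟨ π-keeps (fixedVal C) k k∈S ⟨
    lookup (π (fixedVal C)) k   ∎

  shadow⊆shadowFace : ∀ p → p ∈ₗ shadow → p ∈face shadowFace
  shadow⊆shadowFace p p∈shadow k k∉Y =
    let i , i∈τ , p≡π[αᵢ] = ∈-vertsOf⁻ (π ∘ α) τ p∈shadow in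
    trans (cong (λ q → lookup q k) p≡π[αᵢ])
          (shadow-off-F─S k i∈τ (⊆-outside {V = F ─ S} {Y} F─S⊆Y k (∉⇒lookup≡false k∉Y)))

varyingCoordinates : ∀ {d} → List (Point d) → Subset d
varyingCoordinates ps = tabulate (varies ps)

lookup-proj : ∀ {d} (ps : List (Point d)) p k → lookup (proj ps p) k ≡ (if lookup (varyingCoordinates ps) k then false else lookup p k)
lookup-proj ps p k = trans (lookup∘tabulate _ k) (cong (if_then false else lookup p k) (sym (lookup∘tabulate (varies ps) k)))

proj-keeps : ∀ {d} (ps : List (Point d)) p k → lookup (varyingCoordinates ps) k ≡ false → lookup (proj ps p) k ≡ lookup p k
proj-keeps ps p k k∉S = trans (lookup-proj ps p k) (cong (if_then false else lookup p k) k∉S)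

proj-flattens : ∀ {d} (ps : List (Point d)) p q k → lookup (varyingCoordinates ps) k ≡ true →
  lookup (proj ps p) k ≡ lookup (proj ps q) k
proj-flattens ps p q k k∈S = begin
  lookup (proj ps p) k   ≡⟨ trans (lookup-proj ps p k) (cong (if_then false else lookup p k) k∈S) ⟩
  false                  ≡⟨ trans (lookup-proj ps q k) (cong (if_then false else lookup q k) k∈S) ⟨
  lookup (proj ps q) k   ∎

-- The argument works for any set of flattened coordinates, so the exteriority of σ is not needed.
mainTheorem12 : (d : ℕ) (α : Simplex d) → Nondegenerate α →
    (σ τ : Subset (suc d)) → ExteriorFace α σ → ExteriorFace α τ →
    ExteriorFace (perp α σ) τ
mainTheorem12 d α nd σ τ _ (τ≢∅ , C , τ⊆C) = τ≢∅ , shadowFace , shadow⊆shadowFace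
  where
  open Shadow α nd (varyingCoordinates (vertsOf α σ)) (proj (vertsOf α σ))
                   (proj-keeps (vertsOf α σ)) (proj-flattens (vertsOf α σ)) τ C τ⊆C
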